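{- Let $\mathbf A=(A,\le,0,1)$ be a bounded MLUB-complete poset, $(T,R)$ a time frame with $R$ a serial binary relation, and $P,F,H,G$ the tense operators on $\mathbf A$ induced by $(T,R)$. Let $R^*$ be the relation induced by $P,F,H,G$, and $P^*,F^*,H^*,G^*$ the tense operators on $\mathbf A$ induced by $(T,R^*)$. Then $R\subseteq R^*$ and $P^*=P$, $F^*=F$, $H^*=H$, $G^*=G$.
   Context: For a poset and $X\subseteq A$: $L(X)$, $U(X)$ are the sets of lower/upper bounds of $X$; $\operatorname{Max}X,\operatorname{Min}X$ the sets of maximal/minimal elements. MLUB-complete: for every nonempty $M\subseteq A$, every upper bound of $M$ lies above some minimal upper bound of $M$ and every lower bound lies below some maximal lower bound. $\mathcal P_+(X)$ = nonempty subsets of $X$. For subsets $X,Y$, $X\le Y$ iff $x\le y$ for all $x\in X,y\in Y$. A time frame is $(T,R)$ with $T\ne\emptyset$, $R$ a binary relation on $T$; serial: each $s$ has $r,t$ with $rRs$, $sRt$. For $B\subseteq A^T$, $B(t)=\{q(t)\mid q\in B\}$. Tense operators induced by a time frame $(T,R)$ are the maps $P,F,H,G:\mathcal P_+(A^T)\to(\mathcal P_+A)^T$ with $P(B)(s)=\operatorname{Min}U(\{q(t)\mid q\in B, tRs\})$, $F(B)(s)=\operatorname{Min}U(\{q(t)\mid q\in B, sRt\})$, $H(B)(s)=\operatorname{Max}L(\{q(t)\mid q\in B, tRs\})$, $G(B)(s)=\operatorname{Max}L(\{q(t)\mid q\in B, sRt\})$. The relation induced by maps $P,F,H,G$ is $R^*=\{(s,t)\in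 T^2\mid H(B)(t)\le B(s)\le P(B)(t)\text{ and }G(B)(s)\le B(t)\le F(B)(s)\text{ for all }B\in\mathcal P_+(A^T)\}$. -}

module Defs where

open import Level using (Level; _⊔_; suc)
open import Data.Product using (Σ; ∃; _×_; _,_)
open import Relation.Binary.Bundles using (Poset)
open import Relation.Binary.Core using (Rel; _⇒_)
open import Relation.Binary.PropositionalEquality using (_≡_)
open import Relation.Unary using (Pred)

module _ {c ℓ₁ ℓ₂ : Level} (𝒜 : Poset c ℓ₁ ℓ₂) where
  open Poset 𝒜 renaming (Carrier to A)

  U : ∀ {m} → Pred A m → Pred A (c ⊔ m ⊔ ℓ₂)
  U X a = ∀ x → X x → x ≤ a

  L : ∀ {m} → Pred A m → Pred A (c ⊔ m ⊔ ℓ₂)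
  L X a = ∀ x → X x → a ≤ x

  Min : ∀ {m} → Pred A m → Pred A (c ⊔ m ⊔ ℓ₁ ⊔ ℓ₂)
  Min X a = X a × (∀ y → X y → y ≤ a → y ≈ a)

  Max : ∀ {m} → Pred A m → Pred A (c ⊔ m ⊔ ℓ₁ ⊔ ℓ₂)
  Max X a = X a × (∀ y → X y → a ≤ y → y ≈ a)

  Nonempty : ∀ {m} {X : Set m} {k} → Pred X k → Set (m ⊔ k)
  Nonempty {X = X} M = Σ X M

  MLUB-complete : (m : Level) → Set (suc m ⊔ c ⊔ ℓ₁ ⊔ ℓ₂)
  MLUB-complete m = (M : Pred A m) → Nonempty M →
      (∀ u → U M u → Σ A λ w → Min (U M) w × w ≤ u)
    × (∀ l → L M l → Σ A λ w → Max (L M) w × l ≤ w)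

  Bounded : Set (c ⊔ ℓ₂)
  Bounded = (Σ A λ z → ∀ x → z ≤ x) × (Σ A λ o → ∀ x → x ≤ o)

  _≤ˢ_ : ∀ {m k} → Pred A m → Pred A k → Set (c ⊔ m ⊔ k ⊔ ℓ₂)
  X ≤ˢ Y = ∀ x y → X x → Y y → x ≤ y

  module _ {t : Level} {T : Set t} where

    Serial : ∀ {r} → Rel T r → Set (t ⊔ r)
    Serial R = ∀ s → (Σ T λ r' → R r' s) × (Σ T λ t' → R s t')

    at : ∀ {b} → Pred (T → A) b → T → Pred A (c ⊔ t ⊔ b)
    at B s a = Σ (T → A) λ q → B q × q s ≡ a

    past : ∀ {r b} → Rel T r → Pred (T → A) b → T → Pred A (c ⊔ t ⊔ r ⊔ b)
    past R B s a = Σ (T → A) λ q → Σ T λ t' → B q × R t' s × q t' ≡ a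

    future : ∀ {r b} → Rel T r → Pred (T → A) b → T → Pred A (c ⊔ t ⊔ r ⊔ b)
    future R B s a = Σ (T → A) λ q → Σ T λ t' → B q × R s t' × q t' ≡ a

    Pₒ Fₒ Hₒ Gₒ : ∀ {r b} → Rel T r → Pred (T → A) b → T → Pred A (c ⊔ t ⊔ r ⊔ b ⊔ ℓ₁ ⊔ ℓ₂)
    Pₒ R B s = Min (U (past R B s))
    Fₒ R B s = Min (U (future R B s))
    Hₒ R B s = Max (L (past R B s))
    Gₒ R B s = Max (L (future R B s))

    Induced : (b : Level) {k : Level} →
      (P F H G : Pred (T → A) b → T → Pred A k) → Rel T (suc b ⊔ c ⊔ t ⊔ k ⊔ ℓ₂)
    Induced b P F H G s t' = (B : Pred (T → A) b) → Nonempty B →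
        (H B t' ≤ˢ at B s) × (at B s ≤ˢ P B t')
      × (G B s ≤ˢ at B t') × (at B t' ≤ˢ F B s)

  SameOp : ∀ {t} {T : Set t} {b k k'} →
    (Pred (T → A) b → T → Pred A k) → (Pred (T → A) b → T → Pred A k') → Set _
  SameOp {T = T} {b = b} O O' = (B : Pred (T → A) b) → Nonempty B → (s : T) →
    (∀ a → O B s a → O' B s a) × (∀ a → O' B s a → O B s a)

{-# OPTIONS --safe #-}
-- For sRt the value q s lies in the past of t and q t in the future of s, so the
-- bounds that define P, F, H, G at t (resp. s) compare with B(s) (resp. B(t)):
-- this is R ⊆ R*.  Conversely the defining inequalities of R* say that B(t) lies
-- below every element of P(B)(s) whenever t R* s.  By seriality the past of s is
-- nonempty, so by MLUB-completeness every upper bound of it lies above some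
-- element of P(B)(s), hence above the larger R*-past as well.  Both pasts thus
-- have the same upper bounds and the same minimal upper bounds.  F is the case
-- of the converse relation, and H, G are the cases of the dual poset.
module Submission where

open import Defs
open import Level using (Level; _⊔_)
open import Data.Product using (Σ; _×_; _,_; proj₁; proj₂; swap)
open import Function using (flip)
open import Relation.Binary.Bundles using (Poset)
open import Relation.Binary.Core using (Rel; _⇒_)
open import Relation.Binary.PropositionalEquality using (refl)
open import Relation.Unary using (Pred; _⊆′_; _≐′_)
import Relation.Binary.Properties.Poset as PosetProperties

module Bounds {c ℓ₁ ℓ₂} (𝒜 : Poset c ℓ₁ ℓ₂) where
  open Poset 𝒜 renaming (Carrier to A)

  infix 4 _≤ₛ_
  _≤ₛ_ : ∀ {m k} → Pred A m → Pred A k → Set (c ⊔ m ⊔ k ⊔ ℓ₂)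
  _≤ₛ_ = _≤ˢ_ 𝒜

  U-antitone : ∀ {m k} {X : Pred A m} {Y : Pred A k} → X ⊆′ Y → U 𝒜 Y ⊆′ U 𝒜 X
  U-antitone X⊆Y u u∈UY x x∈X = u∈UY x (X⊆Y x x∈X)

  Min-resp-≐′ : ∀ {m k} {X : Pred A m} {Y : Pred A k} → X ≐′ Y → Min 𝒜 X ≐′ Min 𝒜 Y
  Min-resp-≐′ (X⊆Y , Y⊆X) =
      (λ a (a∈X , minimal) → X⊆Y a a∈X , λ y y∈Y y≤a → minimal y (Y⊆X y y∈Y) y≤a)
    , (λ a (a∈Y , minimal) → Y⊆X a a∈Y , λ y y∈X y≤a → minimal y (X⊆Y y y∈X) y≤a)

  ⊆′⇒≤ₛ-Min-U : ∀ {m k} {X : Pred A m} {Y : Pred A k} → Y ⊆′ X → Y ≤ₛ Min 𝒜 (U 𝒜 X)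
  ⊆′⇒≤ₛ-Min-U Y⊆X y w y∈Y (w∈UX , _) = w∈UX y (Y⊆X y y∈Y)

  U-⊆′-if-≤ₛ-Min-U : ∀ {m k} → MLUB-complete 𝒜 m → {X : Pred A m} {Y : Pred A k} →
    Nonempty 𝒜 X → Y ≤ₛ Min 𝒜 (U 𝒜 X) → U 𝒜 X ⊆′ U 𝒜 Y
  U-⊆′-if-≤ₛ-Min-U mlub {X} X≢∅ Y≤MinUX u u∈UX y y∈Y
    with proj₁ (mlub X X≢∅) u u∈UX
  ... | w , w∈MinUX , w≤u = trans (Y≤MinUX y w y∈Y w∈MinUX) w≤u

module Tense {c ℓ₁ ℓ₂} (𝒜 : Poset c ℓ₁ ℓ₂) {t} {T : Set t} where
  open Poset 𝒜 using () renaming (Carrier to A)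
  open Bounds 𝒜

  past-mono : ∀ {r r' b} (R : Rel T r) (S : Rel T r') → R ⇒ S →
    (B : Pred (T → A) b) (s : T) → past 𝒜 R B s ⊆′ past 𝒜 S B s
  past-mono _ _ R⇒S B s a (q , t' , q∈B , t'Rs , qt'≡a) = q , t' , q∈B , R⇒S t'Rs , qt'≡a

  at⊆′past : ∀ {r b} (R : Rel T r) {B : Pred (T → A) b} {t' s} →
    R t' s → at 𝒜 B t' ⊆′ past 𝒜 R B s
  at⊆′past _ {t' = t'} t'Rs a (q , q∈B , qt'≡a) = q , t' , q∈B , t'Rs , qt'≡a

  past-nonempty : ∀ {r b} (R : Rel T r) {B : Pred (T → A) b} {s} →
    Σ T (λ t' → R t' s) → Nonempty 𝒜 B → Nonempty 𝒜 (past 𝒜 R B s)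
  past-nonempty _ (t' , t'Rs) (q , q∈B) = q t' , q , t' , q∈B , t'Rs , refl

  at≤ₛPₒ : ∀ {r b} (R : Rel T r) {B : Pred (T → A) b} {t' s} →
    R t' s → at 𝒜 B t' ≤ₛ Pₒ 𝒜 R B s
  at≤ₛPₒ R t'Rs = ⊆′⇒≤ₛ-Min-U (at⊆′past R t'Rs)

  past≤ₛPₒ : ∀ {r r' b} (R : Rel T r) (S : Rel T r') {B : Pred (T → A) b} →
    (∀ {t' s} → S t' s → at 𝒜 B t' ≤ₛ Pₒ 𝒜 R B s) → ∀ {s} → past 𝒜 S B s ≤ₛ Pₒ 𝒜 R B s
  past≤ₛPₒ _ _ at≤P _ w (q , t' , q∈B , t'Ss , refl) = at≤P t'Ss (q t') w (q , q∈B , refl)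

  Pₒ-of-dominated-extension : ∀ {r r'} (b : Level) {R : Rel T r} {S : Rel T r'} →
    MLUB-complete 𝒜 (c ⊔ t ⊔ r ⊔ b) → (∀ s → Σ T λ t' → R t' s) → R ⇒ S →
    (∀ (B : Pred (T → A) b) → Nonempty 𝒜 B → ∀ {t' s} → S t' s → at 𝒜 B t' ≤ₛ Pₒ 𝒜 R B s) →
    SameOp 𝒜 (Pₒ 𝒜 {b = b} S) (Pₒ 𝒜 R)
  Pₒ-of-dominated-extension b {R} {S} mlub predecessor R⇒S at≤P B B≢∅ s = Min-resp-≐′
    ( U-antitone (past-mono R S R⇒S B s)
    , U-⊆′-if-≤ₛ-Min-U mlub (past-nonempty R (predecessor s) B≢∅)
        (past≤ₛPₒ R S (at≤P B B≢∅)) )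

-- Over ≥-poset 𝒜, the notions U, Min and Pₒ are definitionally L, Max and Hₒ
-- over 𝒜; likewise Pₒ (flip R) is Fₒ R.
module Duality {c ℓ₁ ℓ₂} (𝒜 : Poset c ℓ₁ ℓ₂) where
  open Poset 𝒜 using () renaming (Carrier to A)
  open PosetProperties 𝒜 using (≥-poset) public

  MLUB-complete-dual : ∀ {m} → MLUB-complete 𝒜 m → MLUB-complete ≥-poset m
  MLUB-complete-dual mlub M M≢∅ = swap (mlub M M≢∅)

  ≤ˢ⇒dual : ∀ {m k} {X : Pred A m} {Y : Pred A k} → _≤ˢ_ 𝒜 X Y → _≤ˢ_ ≥-poset Y X
  ≤ˢ⇒dual X≤Y y x y∈Y x∈X = X≤Y x y x∈X y∈Y

  dual⇒≤ˢ : ∀ {m k} {X : Pred A m} {Y : Pred A k} → _≤ˢ_ ≥-poset X Y → _≤ˢ_ 𝒜 Y X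
  dual⇒≤ˢ X≥Y y x y∈Y x∈X = X≥Y x y x∈X y∈Y

open Tense
open Duality

theorem5p4 : ∀ {c ℓ₁ ℓ₂ t r} (b : Level) (𝒜 : Poset c ℓ₁ ℓ₂) →
    Bounded 𝒜 → (∀ {m} → MLUB-complete 𝒜 m) →
    (T : Set t) (R : Rel T r) → Serial 𝒜 R →
    let P = Pₒ 𝒜 {b = b} R
        F = Fₒ 𝒜 {b = b} R
        H = Hₒ 𝒜 {b = b} R
        G = Gₒ 𝒜 {b = b} R
        R* = Induced 𝒜 b P F H G
    in (R ⇒ R*)
       × SameOp 𝒜 (Pₒ 𝒜 {b = b} R*) P
       × SameOp 𝒜 (Fₒ 𝒜 {b = b} R*) F
       × SameOp 𝒜 (Hₒ 𝒜 {b = b} R*) H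
       × SameOp 𝒜 (Gₒ 𝒜 {b = b} R*) G
theorem5p4 b 𝒜 _ mlub T R serial =
    R⇒R*
  , Pₒ-of-dominated-extension 𝒜 b mlub predecessor R⇒R*
      (λ B B≢∅ t'R*s → proj₁ (proj₂ (t'R*s B B≢∅)))
  , Pₒ-of-dominated-extension 𝒜 b mlub successor R⇒R*
      (λ B B≢∅ sR*t' → proj₂ (proj₂ (proj₂ (sR*t' B B≢∅))))
  , Pₒ-of-dominated-extension (≥-poset 𝒜) b (MLUB-complete-dual 𝒜 mlub) predecessor R⇒R*
      (λ B B≢∅ t'R*s → ≤ˢ⇒dual 𝒜 (proj₁ (t'R*s B B≢∅)))
  , Pₒ-of-dominated-extension (≥-poset 𝒜) b (MLUB-complete-dual 𝒜 mlub) successor R⇒R*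
      (λ B B≢∅ sR*t' → ≤ˢ⇒dual 𝒜 (proj₁ (proj₂ (proj₂ (sR*t' B B≢∅)))))
  where
    predecessor : ∀ s → Σ T λ t' → R t' s
    predecessor s = proj₁ (serial s)

    successor : ∀ s → Σ T λ t' → R s t'
    successor s = proj₂ (serial s)

    R⇒R* : R ⇒ Induced 𝒜 b (Pₒ 𝒜 R) (Fₒ 𝒜 R) (Hₒ 𝒜 R) (Gₒ 𝒜 R)
    R⇒R* sRt' B _ =
        dual⇒≤ˢ 𝒜 (at≤ₛPₒ (≥-poset 𝒜) R sRt')
      , at≤ₛPₒ 𝒜 R sRt'
      , dual⇒≤ˢ 𝒜 (at≤ₛPₒ (≥-poset 𝒜) (flip R) sRt')
      , at≤ₛPₒ 𝒜 (flip R) sRt'
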